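{- If a CLCD formula is satisfied in a finite pseudomodel, it is satisfied in a model.
   Context: Let $N$ be a finite set of agents and $\Theta$ a set of atomic propositions. CLCD-formulas: $\phi ::= p \mid \neg\phi \mid \phi\wedge\phi \mid [H]\phi \mid K_i\phi \mid C_G\phi \mid D_G\phi$ ($H\subseteq N$, $\emptyset\neq G\subseteq N$). An effectivity function $E$ on $S$ is truly playable if for all $s$: (E1) $\emptyset\notin E(G)(s)$; (E2) $S\in E(G)(s)$; (E3) $S\setminus X\notin E(\emptyset)(s)\Rightarrow X\in E(N)(s)$; (E4) if $X\subseteq Y$ and $X\in E(G)(s)$ then $Y\in E(G)(s)$; (E5) $X\in E(G_1)(s)$, $Y\in E(G_2)(s)$, $G_1\cap G_2=\emptyset$ imply $X\cap Y\in E(G_1\cup G_2)(s)$; (E6) the set of $\subseteq$-minimal elements of $E(\emptyset)(s)$ is non-empty. A model is $\langle S,E,\sim_1,\ldots,\sim_n,V\rangle$ with $S$ non-empty, $V$ a valuation, $\sim_i$ equivalence relations and $E$ truly playable; there $D_G\phi$ holds at $s$ iff $\phi$ holds at every $t$ with $(s,t)\in\bigcap_{i\in G}\sim_i$. A pseudomodel is $(S,\{\sim_i\},\{R_G:\emptyset\neq G\subseteq N\},E,V)$ where $(S,E,\{\sim_i\},V)$ is a model, each $R_G$ is an equivalence relation, $R_{\{i\}}=\sim_i$, and $G\subseteq H\Rightarrow R_H\subseteq R_G$; in a pseudomodel $D_G\phi$ is instead interpreted via $R_G$. In both, $[G]\phi$ holds at $s$ iff $\{t:\phi\text{ true at }t\}\in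 E(G)(s)$, $K_i\phi$ is interpreted via $\sim_i$, and $C_G\phi$ holds at $s$ iff $\phi$ holds at every $t$ reachable via $(\bigcup_{i\in G}\sim_i)^*$. -}

module Defs where

open import Data.Nat using (ℕ)
open import Data.Fin using (Fin)
open import Data.Fin.Subset using (Subset; Nonempty; _∈_; _⊆_; _∩_; _∪_; ⊥; ⊤; ⁅_⁆)
open import Data.Product using (Σ; ∃; _×_; _,_)
open import Data.Unit using () renaming (⊤ to Unit)
open import Data.Empty using () renaming (⊥ to False)
open import Relation.Nullary using (¬_)
open import Relation.Binary.PropositionalEquality using (_≡_)
open import Relation.Binary.Structures using (IsEquivalence)
open import Relation.Binary.Construct.Closure.ReflexiveTransitive using (Star)
open import Function.Bundles using (_↔_)

-- Agents are Fin n (the finite set N); coalitions are subsets of Fin n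
-- (Data.Fin.Subset: ⊥ = ∅, ⊤ = N).  Atomic propositions: arbitrary type Θ.

data Formula (n : ℕ) (Θ : Set) : Set where
  atom : Θ → Formula n Θ
  ~_   : Formula n Θ → Formula n Θ
  _∧_  : Formula n Θ → Formula n Θ → Formula n Θ
  [_]_ : Subset n → Formula n Θ → Formula n Θ
  K    : Fin n → Formula n Θ → Formula n Θ
  C    : (G : Subset n) → Nonempty G → Formula n Θ → Formula n Θ
  D    : (G : Subset n) → Nonempty G → Formula n Θ → Formula n Θ

StateSet : Set → Set₁
StateSet S = S → Set

_⊆ₛ_ : {S : Set} → StateSet S → StateSet S → Set
X ⊆ₛ Y = ∀ t → X t → Y t

_∩ₛ_ : {S : Set} → StateSet S → StateSet S → StateSet S
(X ∩ₛ Y) t = X t × Y t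

∁ₛ : {S : Set} → StateSet S → StateSet S
∁ₛ X t = ¬ X t

∅ₛ : {S : Set} → StateSet S
∅ₛ _ = False

Fullₛ : {S : Set} → StateSet S
Fullₛ _ = Unit

EffFun : ℕ → Set → Set₁
EffFun n S = Subset n → S → StateSet S → Set

record TrulyPlayable {n : ℕ} {S : Set} (E : EffFun n S) : Set₁ where
  field
    E1 : ∀ G s → ¬ E G s ∅ₛ
    E2 : ∀ G s → E G s Fullₛ
    E3 : ∀ s X → ¬ E ⊥ s (∁ₛ X) → E ⊤ s X
    E4 : ∀ G s X Y → X ⊆ₛ Y → E G s X → E G s Y
    E5 : ∀ G₁ G₂ s X Y → E G₁ s X → E G₂ s Y → G₁ ∩ G₂ ≡ ⊥ →
         E (G₁ ∪ G₂) s (X ∩ₛ Y)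
    E6 : ∀ s → Σ (StateSet S) λ X → E ⊥ s X ×
                 (∀ Y → E ⊥ s Y → Y ⊆ₛ X → X ⊆ₛ Y)

record Model (n : ℕ) (Θ : Set) : Set₁ where
  field
    S        : Set
    inhabited : S
    E        : EffFun n S
    _∼[_]_   : S → Fin n → S → Set
    ∼-equiv  : ∀ i → IsEquivalence (λ s t → s ∼[ i ] t)
    V        : Θ → StateSet S
    playable : TrulyPlayable E

CKStep : {n : ℕ} {S : Set} → (S → Fin n → S → Set) → Subset n → S → S → Set
CKStep R G s t = ∃ λ i → i ∈ G × R s i t

module ModelSemantics {n : ℕ} {Θ : Set} (M : Model n Θ) where
  open Model M
  infix 4 _⊨_
  _⊨_ : S → Formula n Θ → Set
  s ⊨ atom p    = V p s
  s ⊨ ~ φ       = ¬ (s ⊨ φ)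
  s ⊨ (φ ∧ ψ)   = (s ⊨ φ) × (s ⊨ ψ)
  s ⊨ [ H ] φ   = E H s (λ t → t ⊨ φ)
  s ⊨ K i φ     = ∀ t → s ∼[ i ] t → t ⊨ φ
  s ⊨ C G _ φ   = ∀ t → Star (CKStep _∼[_]_ G) s t → t ⊨ φ
  s ⊨ D G _ φ   = ∀ t → (∀ i → i ∈ G → s ∼[ i ] t) → t ⊨ φ

record Pseudomodel (n : ℕ) (Θ : Set) : Set₁ where
  field
    model   : Model n Θ
  open Model model public
  field
    R        : Subset n → S → S → Set      -- R_G; only used for non-empty G
    R-equiv  : ∀ G → Nonempty G → IsEquivalence (R G)
    R-single : ∀ i s t → (R ⁅ i ⁆ s t → s ∼[ i ] t) × (s ∼[ i ] t → R ⁅ i ⁆ s t)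
    R-anti   : ∀ G H → Nonempty G → G ⊆ H → ∀ s t → R H s t → R G s t

module PseudomodelSemantics {n : ℕ} {Θ : Set} (M : Pseudomodel n Θ) where
  open Pseudomodel M
  infix 4 _⊨_
  _⊨_ : S → Formula n Θ → Set
  s ⊨ atom p    = V p s
  s ⊨ ~ φ       = ¬ (s ⊨ φ)
  s ⊨ (φ ∧ ψ)   = (s ⊨ φ) × (s ⊨ ψ)
  s ⊨ [ H ] φ   = E H s (λ t → t ⊨ φ)
  s ⊨ K i φ     = ∀ t → s ∼[ i ] t → t ⊨ φ
  s ⊨ C G _ φ   = ∀ t → Star (CKStep _∼[_]_ G) s t → t ⊨ φ
  s ⊨ D G _ φ   = ∀ t → R G s t → t ⊨ φ

FinitePseudomodel : {n : ℕ} {Θ : Set} → Pseudomodel n Θ → Set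
FinitePseudomodel M = ∃ λ m → Pseudomodel.S M ↔ Fin m

SatInPseudomodel : {n : ℕ} {Θ : Set} → Pseudomodel n Θ → Formula n Θ → Set
SatInPseudomodel M φ = ∃ λ s → PseudomodelSemantics._⊨_ M s φ

SatInModel : {n : ℕ} {Θ : Set} → Model n Θ → Formula n Θ → Set
SatInModel M φ = ∃ λ s → ModelSemantics._⊨_ M s φ

-- The model is the unravelling of P.  Its states are R-paths
--   s₀ -H₁→ s₁ -H₂→ … -Hₖ→ sₖ     with (sⱼ₋₁, sⱼ) ∈ R_{Hⱼ},
-- and agent i cannot distinguish two paths iff they have the same i-view,
-- where the i-view of a path deletes trailing steps whose coalition contains i.
-- Distributed knowledge of G in the unravelling is the intersection of the
-- relations ∼ᵢ (i ∈ G), and the key combinatorial fact (views-agree⇒R) is that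
-- paths whose i-views agree for all i ∈ G end in R_G-related states: cut both
-- paths back to their last step not labelled by a superset of G; the cut paths
-- are fixed by some i-view with i ∈ G, hence coincide, and the removed suffixes
-- are R_G-chains because R is antitone in the coalition.
-- Effectivity is pulled back from the last state, landing on one-point paths;
-- pulling a truly playable effectivity function back along an injection keeps
-- it truly playable.
module Submission where

open import Defs
open import Data.Nat using (ℕ; suc; _≤_; _<_)
open import Data.Nat.Properties using (≤-refl; <⇒≱; <⇒≤; m<n⇒m<1+n)
open import Data.Product using (Σ; _×_; _,_; proj₁; proj₂)
open import Data.Sum using (_⊎_; inj₁; inj₂)
open import Data.Fin using (Fin)
open import Data.Fin.Subset using (Subset; Nonempty; _∈_; _∉_; _⊆_; ⁅_⁆)
open import Data.Fin.Subset.Properties using (_∈?_; _⊆?_; x∈⁅x⁆; x∈⁅y⁆⇒x≡y)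
open import Data.Fin.Properties using (¬∀⟶∃¬)
open import Data.Unit using (tt) renaming (⊤ to Unit)
open import Data.Empty using (⊥-elim)
open import Function.Base using (_∘_)
open import Function.Bundles using (_⇔_; mk⇔; Equivalence)
open import Function.Definitions using (Injective)
open import Relation.Nullary using (¬_; yes; no)
open import Relation.Nullary.Decidable using (_→-dec_)
open import Relation.Binary.PropositionalEquality
  using (_≡_; refl; sym; trans; cong; subst; module ≡-Reasoning)
open import Relation.Binary.Structures using (IsEquivalence)
open import Relation.Binary.Construct.Closure.ReflexiveTransitive using (Star; ε; _◅_)

⊈⇒witness : ∀ {n} {G H : Subset n} → ¬ (G ⊆ H) → Σ (Fin n) λ i → i ∈ G × i ∉ H
⊈⇒witness {n} {G} {H} G⊈H
  with ¬∀⟶∃¬ n (λ i → i ∈ G → i ∈ H) (λ i → (i ∈? G) →-dec (i ∈? H))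
               (λ G⊆H → G⊈H (λ {i} → G⊆H i))
... | i , ¬[i∈G→i∈H] with i ∈? G
...   | yes i∈G = i , i∈G , λ i∈H → ¬[i∈G→i∈H] (λ _ → i∈H)
...   | no  i∉G = ⊥-elim (¬[i∈G→i∈H] (⊥-elim ∘ i∉G))

⁅⁆⊆ : ∀ {n} {i : Fin n} {H : Subset n} → i ∈ H → ⁅ i ⁆ ⊆ H
⁅⁆⊆ {H = H} i∈H j∈⁅i⁆ = subst (_∈ H) (sym (x∈⁅y⁆⇒x≡y _ j∈⁅i⁆)) i∈H

-- Given f : S' → S and an injection g : S → S', coalition G is effective
-- for X ⊆ S' at p iff it is effective for g⁻¹(X) at f p.  E1–E5 transfer
-- pointwise; for E6 the image under g of a minimal set is minimal.

module Pullback {n : ℕ} {S S' : Set} (f : S' → S) (g : S → S') (g-inj : Injective _≡_ _≡_ g) where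

  pullback : EffFun n S → EffFun n S'
  pullback E G p X = E G (f p) (X ∘ g)

  image : StateSet S → StateSet S'
  image X q = Σ S λ t → g t ≡ q × X t

  image-preimage : ∀ X → X ⊆ₛ (image X ∘ g)
  image-preimage X t x = t , refl , x

  preimage-image : ∀ X → (image X ∘ g) ⊆ₛ X
  preimage-image X t (t' , gt'≡gt , x) = subst X (g-inj gt'≡gt) x

  pullback-playable : ∀ {E} → TrulyPlayable E → TrulyPlayable (pullback E)
  pullback-playable {E} playable = record
    { E1 = λ G p → E1 G (f p)
    ; E2 = λ G p → E2 G (f p)
    ; E3 = λ p X → E3 (f p) (X ∘ g)
    ; E4 = λ G p X Y X⊆Y → E4 G (f p) _ _ (λ t → X⊆Y (g t))
    ; E5 = λ G₁ G₂ p X Y → E5 G₁ G₂ (f p) (X ∘ g) (Y ∘ g)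
    ; E6 = minimal
    }
    where
      open TrulyPlayable playable
      minimal : ∀ p → Σ (StateSet S') λ X → pullback E _ p X ×
                  (∀ Y → pullback E _ p Y → Y ⊆ₛ X → X ⊆ₛ Y)
      minimal p with E6 (f p)
      ... | X , EX , X-min =
        image X , E4 _ (f p) X _ (image-preimage X) EX , image-min
        where
          image-min : ∀ Y → pullback E _ p Y → Y ⊆ₛ image X → image X ⊆ₛ Y
          image-min Y EY Y⊆imX q (t , refl , x) =
            X-min (Y ∘ g) EY (λ u y → preimage-image X u (Y⊆imX (g u) y)) t x

module Paths {n : ℕ} (S : Set) where

  data Path : Set where
    root : S → Path
    ext  : Path → Subset n → S → Path

  last : Path → S
  last (root s)    = s
  last (ext _ _ t) = t

  len : Path → ℕ
  len (root _)    = 0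
  len (ext p _ _) = suc (len p)

  view : Fin n → Path → Path
  view i (root s) = root s
  view i (ext p H t) with i ∈? H
  ... | yes _ = view i p
  ... | no  _ = ext p H t

  view-∈ : ∀ {i H} p t → i ∈ H → view i (ext p H t) ≡ view i p
  view-∈ {i} {H} p t i∈H with i ∈? H
  ... | yes _   = refl
  ... | no  i∉H = ⊥-elim (i∉H i∈H)

  view-∉ : ∀ {i H} p t → i ∉ H → view i (ext p H t) ≡ ext p H t
  view-∉ {i} {H} p t i∉H with i ∈? H
  ... | yes i∈H = ⊥-elim (i∉H i∈H)
  ... | no  _   = refl

  view-shrinks : ∀ i p → view i p ≡ p ⊎ len (view i p) < len p
  view-shrinks i (root s) = inj₁ refl
  view-shrinks i (ext p H t) with i ∈? H
  ... | no  _ = inj₁ refl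
  ... | yes _ with view-shrinks i p
  ...   | inj₁ view≡p = inj₂ (subst (λ q → len q < suc (len p)) (sym view≡p) ≤-refl)
  ...   | inj₂ shorter = inj₂ (m<n⇒m<1+n shorter)

  len-view : ∀ i p → len (view i p) ≤ len p
  len-view i p with view-shrinks i p
  ... | inj₁ view≡p = subst (λ q → len q ≤ len p) (sym view≡p) ≤-refl
  ... | inj₂ shorter = <⇒≤ shorter

  view-not-shorter : ∀ i p → len p ≤ len (view i p) → view i p ≡ p
  view-not-shorter i p long with view-shrinks i p
  ... | inj₁ view≡p = view≡p
  ... | inj₂ shorter = ⊥-elim (<⇒≱ shorter long)

  -- Two paths each fixed by the view of an agent on which they agree with
  -- the other path are equal: each is a prefix of the other.
  fixed-views-agree : ∀ i j a b → view i a ≡ a → view j b ≡ b →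
                      view i a ≡ view i b → view j a ≡ view j b → a ≡ b
  fixed-views-agree i j a b ia≡a jb≡b ia≡ib ja≡jb = begin
      a        ≡⟨ a≡ib ⟩
      view i b ≡⟨ view-not-shorter i b (subst (λ q → len b ≤ len q) a≡ib b≤a) ⟩
      b        ∎
    where
      open ≡-Reasoning
      a≡ib : a ≡ view i b
      a≡ib = trans (sym ia≡a) ia≡ib
      b≤a : len b ≤ len a
      b≤a = subst (λ q → len q ≤ len a) (trans ja≡jb jb≡b) (len-view j a)

  cut : Subset n → Path → Path
  cut G (root s) = root s
  cut G (ext p H t) with G ⊆? H
  ... | yes _ = cut G p
  ... | no  _ = ext p H t

  cut-fixed : ∀ G → Nonempty G → ∀ p → Σ (Fin n) λ i → i ∈ G × view i (cut G p) ≡ cut G p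
  cut-fixed G (i , i∈G) (root s) = i , i∈G , refl
  cut-fixed G G≠∅ (ext p H t) with G ⊆? H
  ... | yes _   = cut-fixed G G≠∅ p
  ... | no  G⊈H with ⊈⇒witness G⊈H
  ...   | i , i∈G , i∉H = i , i∈G , view-∉ p t i∉H

  view-cut : ∀ {i G} p → i ∈ G → view i p ≡ view i (cut G p)
  view-cut (root s) i∈G = refl
  view-cut {i} {G} (ext p H t) i∈G with G ⊆? H
  ... | yes G⊆H = trans (view-∈ p t (G⊆H i∈G)) (view-cut p i∈G)
  ... | no  _   = refl

  views-agree⇒cut≡ : ∀ G → Nonempty G → ∀ p q →
                     (∀ i → i ∈ G → view i p ≡ view i q) → cut G p ≡ cut G q
  views-agree⇒cut≡ G G≠∅ p q agree
    with cut-fixed G G≠∅ p | cut-fixed G G≠∅ q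
  ... | i , i∈G , fixᵢ | j , j∈G , fixⱼ =
    fixed-views-agree i j (cut G p) (cut G q) fixᵢ fixⱼ (agree-cut i∈G) (agree-cut j∈G)
    where
      agree-cut : ∀ {k} → k ∈ G → view k (cut G p) ≡ view k (cut G q)
      agree-cut {k} k∈G =
        trans (sym (view-cut p k∈G)) (trans (agree k k∈G) (view-cut q k∈G))

module Unravelling {n : ℕ} {Θ : Set} (P : Pseudomodel n Θ) where
  open Pseudomodel P
  open Paths {n} S
  module ∼ (i : Fin n) = IsEquivalence (∼-equiv i)
  module R (G : Subset n) (G≠∅ : Nonempty G) = IsEquivalence (R-equiv G G≠∅)

  Valid : Path → Set
  Valid (root _)    = Unit
  Valid (ext p H t) = Valid p × R H (last p) t

  -- An R_H-step is a ∼ᵢ-step for every member i of H (R_{i} = ∼ᵢ, R antitone).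
  R-step-∼ : ∀ {i H s t} → i ∈ H → R H s t → s ∼[ i ] t
  R-step-∼ {i} {H} {s} {t} i∈H r =
    proj₁ (R-single i s t) (R-anti ⁅ i ⁆ H (i , x∈⁅x⁆ i) (⁅⁆⊆ i∈H) s t r)

  view-∼ : ∀ i p → Valid p → last (view i p) ∼[ i ] last p
  view-∼ i (root s) _ = ∼.refl i
  view-∼ i (ext p H t) (valid , r) with i ∈? H
  ... | yes i∈H = ∼.trans i (view-∼ i p valid) (R-step-∼ i∈H r)
  ... | no  _   = ∼.refl i

  cut-R : ∀ G → (G≠∅ : Nonempty G) → ∀ p → Valid p → R G (last (cut G p)) (last p)
  cut-R G G≠∅ (root s) _ = R.refl G G≠∅
  cut-R G G≠∅ (ext p H t) (valid , r) with G ⊆? H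
  ... | yes G⊆H = R.trans G G≠∅ (cut-R G G≠∅ p valid) (R-anti G H G≠∅ G⊆H (last p) t r)
  ... | no  _   = R.refl G G≠∅

  views-agree⇒R : ∀ G → (G≠∅ : Nonempty G) → ∀ p q → Valid p → Valid q →
                  (∀ i → i ∈ G → view i p ≡ view i q) → R G (last p) (last q)
  views-agree⇒R G G≠∅ p q vp vq agree =
    R.trans G G≠∅ (R.sym G G≠∅ (cut-R G G≠∅ p vp))
      (subst (λ c → R G (last c) (last q)) (sym (views-agree⇒cut≡ G G≠∅ p q agree))
             (cut-R G G≠∅ q vq))

  State : Set
  State = Σ Path Valid

  endpoint : State → S
  endpoint = last ∘ proj₁

  point : S → State
  point s = root s , tt

  point-injective : Injective _≡_ _≡_ point
  point-injective = cong endpoint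

  _≈[_]_ : State → Fin n → State → Set
  p ≈[ i ] q = view i (proj₁ p) ≡ view i (proj₁ q)

  open Pullback {n} endpoint point point-injective

  unravelled : Model n Θ
  unravelled = record
    { S         = State
    ; inhabited = point inhabited
    ; E         = pullback E
    ; _∼[_]_    = _≈[_]_
    ; ∼-equiv   = λ i → record { refl = refl ; sym = sym ; trans = trans }
    ; V         = λ a → V a ∘ endpoint
    ; playable  = pullback-playable playable
    }

  ≈⇒∼ : ∀ {i} p q → p ≈[ i ] q → endpoint p ∼[ i ] endpoint q
  ≈⇒∼ {i} (p , vp) (q , vq) same-view =
    ∼.trans i (∼.sym i (view-∼ i p vp))
      (subst (λ v → last v ∼[ i ] last q) (sym same-view) (view-∼ i q vq))

  extend : ∀ G (p : State) t → R G (endpoint p) t → State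
  extend G (p , vp) t r = ext p G t , vp , r

  extend-≈ : ∀ {i G} p t r → i ∈ G → p ≈[ i ] extend G p t r
  extend-≈ (p , _) t _ i∈G = sym (view-∈ p t i∈G)

  extend-∼ : ∀ i (p : State) t → endpoint p ∼[ i ] t → State
  extend-∼ i p t r = extend ⁅ i ⁆ p t (proj₂ (R-single i (endpoint p) t) r)

  extend-∼-≈ : ∀ i p t r → p ≈[ i ] extend-∼ i p t r
  extend-∼-≈ i p t r = extend-≈ p t (proj₂ (R-single i (endpoint p) t) r) (x∈⁅x⁆ i)

  reach-down : ∀ {G p q} → Star (CKStep _≈[_]_ G) p q →
               Star (CKStep _∼[_]_ G) (endpoint p) (endpoint q)
  reach-down ε = ε
  reach-down {p = p} (_◅_ {j = p'} (i , i∈G , p≈p') rest) =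
    (i , i∈G , ≈⇒∼ p p' p≈p') ◅ reach-down rest

  reach-up : ∀ {G} p t → Star (CKStep _∼[_]_ G) (endpoint p) t →
             Σ State λ q → Star (CKStep _≈[_]_ G) p q × endpoint q ≡ t
  reach-up p _ ε = p , ε , refl
  reach-up p t ((i , i∈G , r) ◅ rest)
    with reach-up (extend-∼ i p _ r) t rest
  ... | q , path , end≡t = q , (i , i∈G , extend-∼-≈ i p _ r) ◅ path , end≡t

  open Equivalence using (to; from)
  open PseudomodelSemantics P renaming (_⊨_ to _⊨ₚ_)
  open ModelSemantics unravelled renaming (_⊨_ to _⊨ᵤ_)

  truth : ∀ φ p → (p ⊨ᵤ φ) ⇔ (endpoint p ⊨ₚ φ)
  truth (atom a)  p = mk⇔ (λ x → x) (λ x → x)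
  truth (~ φ)     p = mk⇔ (λ ¬u → ¬u ∘ from (truth φ p)) (λ ¬e → ¬e ∘ to (truth φ p))
  truth (φ ∧ ψ)   p =
    mk⇔ (λ (u , v) → to (truth φ p) u , to (truth ψ p) v)
        (λ (u , v) → from (truth φ p) u , from (truth ψ p) v)
  truth ([ H ] φ) p =
    mk⇔ (E4 H (endpoint p) _ _ (λ t → to (truth φ (point t))))
        (E4 H (endpoint p) _ _ (λ t → from (truth φ (point t))))
    where open TrulyPlayable playable
  truth (K i φ)   p =
    mk⇔ (λ u t r → to (truth φ (extend-∼ i p t r)) (u _ (extend-∼-≈ i p t r)))
        (λ e q p≈q → from (truth φ q) (e (endpoint q) (≈⇒∼ p q p≈q)))
  truth (C G _ φ) p =
    mk⇔ (λ u t reach → let (q , path , end≡t) = reach-up p t reach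
                       in subst (_⊨ₚ φ) end≡t (to (truth φ q) (u q path)))
        (λ e q path → from (truth φ q) (e (endpoint q) (reach-down path)))
  truth (D G G≠∅ φ) p@(path , valid) =
    mk⇔ (λ u t r → to (truth φ (extend G p t r)) (u _ (λ i i∈G → extend-≈ p t r i∈G)))
        (λ e q agree → from (truth φ q)
                         (e (endpoint q) (views-agree⇒R G G≠∅ path (proj₁ q) valid (proj₂ q) agree)))

theorem5 : (n : ℕ) (Θ : Set) (φ : Formula n Θ) →
    Σ (Pseudomodel n Θ) (λ M → FinitePseudomodel M × SatInPseudomodel M φ) →
    Σ (Model n Θ) (λ M → SatInModel M φ)
theorem5 n Θ φ (P , _ , (s , s⊨φ)) =
  unravelled , point s , Equivalence.from (truth φ (point s)) s⊨φ
  where open Unravelling P
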